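{- Let $N$ be a homogeneous network with asymmetric inputs with set of cells $C$, backward connected for a cell $c$, and let $\tilde{N}$ be its fundamental network with set of cells $\tilde{C}$. Then $N$ is a subnetwork of $\tilde{N}$ (up to isomorphism) if and only if there is $\sigma\in\tilde{C}$ such that for all $\sigma',\sigma''\in\tilde{C}$: $\sigma'\circ\sigma=\sigma''\circ\sigma$ if and only if $\sigma'(c)=\sigma''(c)$.
   Context: A homogeneous network with asymmetric inputs has a finite cell set $C$, one cell type, $k$ edge types, each cell receiving exactly one edge of each type; it is represented by $\sigma_1,\dots,\sigma_k:C\to C$ (type-$i$ edge into $c$ comes from $\sigma_i(c)$). $S$ is a subnetwork of $M$ if its cells form a subset of $M$'s cells such that every edge of $M$ targeting a cell of $S$ belongs to $S$ and has its source in $S$; up to isomorphism, $S$ is a subnetwork of $M$ iff there is an injective network fibration $S\to M$ (for asymmetric inputs: an injective cell map commuting with the representing functions). $N$ is backward connected for $c$ if every cell $c'\neq c$ has a directed path to $c$. The fundamental network $\tilde{N}$ has as cells the semigroup $\tilde{C}$ of maps $C\to C$ generated under composition by $Id_C,\sigma_1,\dots,\sigma_k$, represented by $\tilde{\sigma}_i(\gamma)=\sigma_i\circ\gamma$. -}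

module Defs where

open import Data.Nat using (ℕ)
open import Data.Fin using (Fin)
open import Data.List using (List; []; _∷_)
open import Data.Product using (Σ; ∃; _×_)
open import Function using (_∘_; id)
open import Relation.Binary.PropositionalEquality using (_≡_; _≗_; _≢_)
open import Relation.Binary.Construct.Closure.Transitive using (TransClosure)

-- A homogeneous network with asymmetric inputs on cells Fin n with k edge types:
-- σ i c is the source of the type-i edge into cell c.
Network : ℕ → ℕ → Set
Network n k = Fin k → Fin n → Fin n

module _ {n k : ℕ} (σ : Network n k) where

  Edge : Fin n → Fin n → Set
  Edge a b = ∃ λ i → σ i b ≡ a

  PathTo : Fin n → Fin n → Set
  PathTo = TransClosure Edge

  BackwardConnected : Fin n → Set
  BackwardConnected c = ∀ c' → c' ≢ c → PathTo c' c

  -- Elements of the fundamental semigroup C̃ are presented by words in the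
  -- generators: eval [] = Id_C, eval (i ∷ w) = σ i ∘ eval w.  Every element of
  -- the semigroup generated by Id, σ_1..σ_k is eval of some word, and two words
  -- denote the same element of C̃ iff their evaluations agree pointwise (_≗_).
  Word : Set
  Word = List (Fin k)

  eval : Word → Fin n → Fin n
  eval []      = id
  eval (i ∷ w) = σ i ∘ eval w

  -- N is (up to isomorphism) a subnetwork of the fundamental network Ñ:
  -- there is an injective network fibration φ : C → C̃, i.e. an injective cell
  -- map with φ (σ i x) = σ̃ i (φ x) = σ i ∘ φ x  (equalities in C̃).
  SubnetworkOfFundamental : Set
  SubnetworkOfFundamental =
    Σ (Fin n → Word) λ φ →
      (∀ a b → eval (φ a) ≗ eval (φ b) → a ≡ b) ×
      (∀ i x → eval (φ (σ i x)) ≗ (σ i ∘ eval (φ x)))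

-- Backward connectivity gives every cell x a word w_x with w_x(c) = x.
-- Forward: an injective fibration φ commutes with words, φ(w x) = w ∘ φ(x),
-- so s = φ(c) separates exactly as c does, by injectivity of φ.
-- Backward: x ↦ w_x ∘ s is injective because s separates as c does, and it is
-- a fibration because (w_{σ_i x}) ∘ s and σ_i ∘ w_x ∘ s agree at c.
module Submission where

open import Defs
open import Data.Nat using (ℕ)
open import Data.Fin using (Fin; _≟_)
open import Data.Product using (Σ; ∃; _,_; proj₁; proj₂)
open import Data.List using ([]; _∷_; _++_)
open import Function using (_∘_; _⇔_; mk⇔; Equivalence)
open import Relation.Binary.PropositionalEquality
  using (_≡_; _≗_; refl; sym; trans; cong; module ≡-Reasoning)
open import Relation.Binary.Construct.Closure.Transitive using ([_]; _∷_)
open import Relation.Nullary using (yes; no)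

open Equivalence using (to; from)

module _ {n k : ℕ} (σ : Network n k) where

  IsFibration : (Fin n → Word σ) → Set
  IsFibration φ = ∀ i x → eval σ (φ (σ i x)) ≗ (σ i ∘ eval σ (φ x))

  Injective≗ : (Fin n → Word σ) → Set
  Injective≗ φ = ∀ a b → eval σ (φ a) ≗ eval σ (φ b) → a ≡ b

  SeparatesLike : Fin n → Word σ → Set
  SeparatesLike c s = ∀ (s′ s″ : Word σ) →
    ((eval σ s′ ∘ eval σ s) ≗ (eval σ s″ ∘ eval σ s)) ⇔ (eval σ s′ c ≡ eval σ s″ c)

  eval-++ : ∀ (w v : Word σ) x → eval σ (w ++ v) x ≡ eval σ w (eval σ v x)
  eval-++ []      v x = refl
  eval-++ (i ∷ w) v x = cong (σ i) (eval-++ w v x)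

  path⇒word : ∀ {a b} → PathTo σ a b → ∃ λ w → eval σ w b ≡ a
  path⇒word [ i , p ] = i ∷ [] , p
  path⇒word ((i , p) ∷ r) with path⇒word r
  ... | w , q = i ∷ w , trans (cong (σ i) q) p

  backwardConnected⇒reachable : ∀ {c} → BackwardConnected σ c →
                                ∀ x → ∃ λ w → eval σ w c ≡ x
  backwardConnected⇒reachable {c} bc x with x ≟ c
  ... | yes x≡c = [] , sym x≡c
  ... | no  x≢c = path⇒word (bc x x≢c)

  fibration-eval : ∀ φ → IsFibration φ →
                   ∀ w x → eval σ (φ (eval σ w x)) ≗ (eval σ w ∘ eval σ (φ x))
  fibration-eval φ fib []      x y = refl
  fibration-eval φ fib (i ∷ w) x y = trans (fib i (eval σ w x) y) (cong (σ i) (fibration-eval φ fib w x y))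

  injectiveFibration⇒separatesLike : ∀ φ c → Injective≗ φ → IsFibration φ →
                                     SeparatesLike c (φ c)
  injectiveFibration⇒separatesLike φ c inj fib s′ s″ = mk⇔ ⇒ ⇐
    where
    open ≡-Reasoning
    ⇒ : (eval σ s′ ∘ eval σ (φ c)) ≗ (eval σ s″ ∘ eval σ (φ c)) → eval σ s′ c ≡ eval σ s″ c
    ⇒ e = inj _ _ λ y → begin
      eval σ (φ (eval σ s′ c)) y  ≡⟨ fibration-eval φ fib s′ c y ⟩
      eval σ s′ (eval σ (φ c) y)  ≡⟨ e y ⟩
      eval σ s″ (eval σ (φ c) y)  ≡⟨ fibration-eval φ fib s″ c y ⟨
      eval σ (φ (eval σ s″ c)) y  ∎
    ⇐ : eval σ s′ c ≡ eval σ s″ c → (eval σ s′ ∘ eval σ (φ c)) ≗ (eval σ s″ ∘ eval σ (φ c))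
    ⇐ e y = begin
      eval σ s′ (eval σ (φ c) y)  ≡⟨ fibration-eval φ fib s′ c y ⟨
      eval σ (φ (eval σ s′ c)) y  ≡⟨ cong (λ z → eval σ (φ z) y) e ⟩
      eval σ (φ (eval σ s″ c)) y  ≡⟨ fibration-eval φ fib s″ c y ⟩
      eval σ s″ (eval σ (φ c) y)  ∎

  module _ {c : Fin n} (bc : BackwardConnected σ c) (s : Word σ) (sep : SeparatesLike c s) where

    private
      address : Fin n → Word σ
      address x = proj₁ (backwardConnected⇒reachable bc x)

      address-spec : ∀ x → eval σ (address x) c ≡ x
      address-spec x = proj₂ (backwardConnected⇒reachable bc x)

    addressThrough : Fin n → Word σ
    addressThrough x = address x ++ s

    addressThrough-injective : Injective≗ addressThrough
    addressThrough-injective a b e = begin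
      a                          ≡⟨ address-spec a ⟨
      eval σ (address a) c       ≡⟨ to (sep (address a) (address b)) e′ ⟩
      eval σ (address b) c       ≡⟨ address-spec b ⟩
      b                          ∎
      where
      open ≡-Reasoning
      e′ : (eval σ (address a) ∘ eval σ s) ≗ (eval σ (address b) ∘ eval σ s)
      e′ y = trans (sym (eval-++ (address a) s y)) (trans (e y) (eval-++ (address b) s y))

    addressThrough-fibration : IsFibration addressThrough
    addressThrough-fibration i x y = begin
      eval σ (address (σ i x) ++ s) y        ≡⟨ eval-++ (address (σ i x)) s y ⟩
      eval σ (address (σ i x)) (eval σ s y)  ≡⟨ from (sep (address (σ i x)) (i ∷ address x)) agreeAt-c y ⟩
      σ i (eval σ (address x) (eval σ s y))  ≡⟨ cong (σ i) (eval-++ (address x) s y) ⟨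
      σ i (eval σ (address x ++ s) y)        ∎
      where
      open ≡-Reasoning
      agreeAt-c : eval σ (address (σ i x)) c ≡ σ i (eval σ (address x) c)
      agreeAt-c = trans (address-spec (σ i x)) (cong (σ i) (sym (address-spec x)))

mainTheorem10 : {n k : ℕ} (σ : Network n k) (c : Fin n) →
    BackwardConnected σ c →
    SubnetworkOfFundamental σ ⇔
      Σ (Word σ) (λ s → ∀ (s′ s″ : Word σ) →
        ((eval σ s′ ∘ eval σ s) ≗ (eval σ s″ ∘ eval σ s)) ⇔ (eval σ s′ c ≡ eval σ s″ c))
mainTheorem10 σ c bc = mk⇔
  (λ (φ , inj , fib) → φ c , injectiveFibration⇒separatesLike σ φ c inj fib)
  (λ (s , sep) → addressThrough σ bc s sep ,
                 addressThrough-injective σ bc s sep ,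
                 addressThrough-fibration σ bc s sep)
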